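{- For integers $b\geq 0$ the following hold: $n(1,b,5)=b+2$ for even $b\geq 2$; $n(1,b,5)=b+3$ for odd $b\geq 3$; $n(2,b,5)=b+5$; $n(1,b,6)=2b+2$ for $b\geq 1$; $n(2,b,6)=2b+6$.
   Context: A weighted graph (wgraph) is a pair $G=(L,H)$ of simple finite graphs with $V(L)=V(H)$ and $E(L)\cap E(H)=\varnothing$; edges of $L$ are light (weight 1) and edges of $H$ are heavy (weight 2). A wcycle is a cycle (of length at least 3) in the graph with edge set $E(L)\cup E(H)$; its weight is the sum of the weights of its edges. The girth of $G$ is the minimum weight of a wcycle. $G$ is $(a,b)$-regular if $L$ is $a$-regular and $H$ is $b$-regular. An $(a,b,g)$-wgraph is an $(a,b)$-regular wgraph of girth $g$. $n(a,b,g)$ denotes the minimum order of an $(a,b,g)$-wgraph ($\infty$ if none exists). -}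

module Defs where

open import Data.Nat using (ℕ; zero; suc; _+_; _*_; _≤_; _<_)
open import Data.Bool using (Bool; true; false; if_then_else_; _∨_; _∧_; T)
open import Data.Fin using (Fin)
open import Data.List using (List; []; _∷_; _++_; [_]; length; map; allFin)
open import Data.Nat.ListAction using (sum)
open import Data.List.Relation.Unary.All using (All)
open import Data.List.Relation.Unary.Unique.Propositional using (Unique)
open import Data.Product using (Σ; _×_; _,_; ∃; proj₁; proj₂)
open import Relation.Binary.PropositionalEquality using (_≡_)
open import Relation.Nullary using (¬_)

record WGraph (N : ℕ) : Set where
  field
    L : Fin N → Fin N → Bool
    H : Fin N → Fin N → Bool
    L-sym   : ∀ u v → L u v ≡ L v u
    H-sym   : ∀ u v → H u v ≡ H v u
    L-irr   : ∀ v → L v v ≡ false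
    H-irr   : ∀ v → H v v ≡ false
    disjoint : ∀ u v → (L u v ∧ H u v) ≡ false
open WGraph public

deg : {N : ℕ} → (Fin N → Fin N → Bool) → Fin N → ℕ
deg {N} A v = sum (map (λ u → if A v u then 1 else 0) (allFin N))

IsRegular : {N : ℕ} → WGraph N → ℕ → ℕ → Set
IsRegular G a b = (∀ v → deg (L G) v ≡ a) × (∀ v → deg (H G) v ≡ b)

consec : {A : Set} → List A → List (A × A)
consec (x ∷ y ∷ zs) = (x , y) ∷ consec (y ∷ zs)
consec _ = []

cycleEdges : {A : Set} → List A → List (A × A)
cycleEdges [] = []
cycleEdges (x ∷ xs) = consec (x ∷ xs ++ [ x ])

IsWCycle : {N : ℕ} → WGraph N → List (Fin N) → Set
IsWCycle G xs =
  (3 ≤ length xs) × Unique xs ×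
  All (λ e → T (L G (proj₁ e) (proj₂ e) ∨ H G (proj₁ e) (proj₂ e))) (cycleEdges xs)

edgeWeight : {N : ℕ} → WGraph N → Fin N → Fin N → ℕ
edgeWeight G u v = if L G u v then 1 else (if H G u v then 2 else 0)

weight : {N : ℕ} → WGraph N → List (Fin N) → ℕ
weight G xs = sum (map (λ e → edgeWeight G (proj₁ e) (proj₂ e)) (cycleEdges xs))

-- girth of G equals g (minimum weight of a wcycle; a wgraph without
-- wcycles has infinite girth and satisfies this for no g)
HasGirth : {N : ℕ} → WGraph N → ℕ → Set
HasGirth G g =
  (Σ (List _) λ xs → IsWCycle G xs × weight G xs ≡ g) ×
  (∀ xs → IsWCycle G xs → g ≤ weight G xs)

ExistsWGraph : ℕ → ℕ → ℕ → ℕ → Set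
ExistsWGraph a b g N = Σ (WGraph N) λ G → IsRegular G a b × HasGirth G g

MinOrder : ℕ → ℕ → ℕ → ℕ → Set
MinOrder a b g N = ExistsWGraph a b g N × (∀ M → M < N → ¬ ExistsWGraph a b g M)

{-# OPTIONS --safe #-}

-- Every wcycle weighs at least g, so a short non-backtracking
-- light path from a vertex v has distinct vertices, none of them a heavy
-- neighbour of v (a wcycle closing through them would be too light); for
-- g = 6 the heavy neighbourhoods of the two ends of a light edge are moreover
-- disjoint. Counting gives N ≥ b + 2, b + 5, 2b + 2 and 2b + 6. For a = 1 the
-- light edges form a perfect matching, so N is even, which raises b + 2 to
-- b + 3 when b is odd.
--
-- Constructions. (1,b,5): the complete graph with a light perfect matching,
-- minus a second perfect matching when b is odd. (1,b,6): K_{b+1,b+1} with a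
-- light perfect matching. (2,b,5): a light Hamiltonian cycle, heavy edges
-- between vertices at cyclic distance at least 3. (2,b,6): a light cycle of
-- length 2b + 6, heavy edges between vertices of equal parity at distance at
-- least 4. A wcycle of weight below g would need consecutive light edges that
-- close up quickly; but light edges of a matching never meet, a
-- non-backtracking light walk along a cycle keeps its direction, and parity
-- rules out the remaining short odd wcycles.
module Submission where

open import Defs
open import Data.Bool using (Bool; true; false; T; not; _∧_; _∨_; _xor_; if_then_else_)
open import Data.Bool.Properties
  using (not-involutive; not-¬; xor-comm; xor-same; not-distribˡ-xor; T-∧; T-∨; T-≡;
         ∨-identityʳ; ∧-identityʳ; ∨-zeroʳ)
open import Data.Empty using (⊥; ⊥-elim)
open import Data.Fin using (Fin; zero; suc; toℕ; fromℕ; fromℕ<; inject₁)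
open import Data.Fin.Patterns using (0F; 1F; 2F; 3F; 4F; 5F; 6F)
open import Data.Fin.Properties using (_≟_; any?; toℕ-injective; toℕ-fromℕ<; toℕ-fromℕ; toℕ-inject₁; toℕ<n)
open import Data.List using (List; []; _∷_; _++_; [_]; length; map; tabulate)
open import Data.List.Membership.Propositional using (_∈_; _∉_)
import Data.List.Membership.DecPropositional as DecMembership
open import Data.List.Properties using (map-tabulate; length-map; length-++)
open import Data.List.Relation.Unary.All as All using (All; []; _∷_)
open import Data.List.Relation.Unary.AllPairs using ([]; _∷_; allPairs?)
open import Data.List.Relation.Unary.Any using (here; there)
open import Data.List.Relation.Unary.Unique.Propositional using (Unique)
open import Data.Nat using (ℕ; zero; suc; _+_; _*_; _∸_; _≤_; _<_; z≤n; s≤s; _<ᵇ_; _≤ᵇ_; _<?_; _≤?_)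
open import Data.Nat.DivMod using (_%_; m%n<n; m%n%n≡m%n; %-distribˡ-+; m<n⇒m%n≡m; m≤n⇒[n∸m]%m≡n%m; [m+n]%n≡m%n)
open import Data.Nat.GeneralisedArithmetic using (iterate)
open import Data.Nat.ListAction using (sum)
open import Data.Nat.Properties hiding (_≟_)
open import Algebra.Properties.CommutativeMonoid.Sum +-0-commutativeMonoid
  using (sum-syntax; sum-cong-≗; ∑-distrib-+; sum-replicate-zero)
open import Data.Nat.Solver using (module +-*-Solver)
open import Data.Product using (∃; _×_; _,_; proj₁; proj₂)
open import Data.Sum as Sum using (_⊎_; inj₁; inj₂; [_,_]′)
open import Function using (_∘_; id)
open import Function.Bundles using (Equivalence; mk⇔)
open import Relation.Binary.PropositionalEquality hiding ([_])
open import Relation.Nullary using (¬_; Dec; yes; no; contradiction)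
open import Relation.Nullary.Decidable
  using (⌊_⌋; True; T?; ¬?; _×-dec_; toWitness; fromWitness; toWitnessFalse; fromWitnessFalse;
         decidable-stable; isYes≗does; does-⇔; dec-true; dec-false)

open module FinMembership {N} = DecMembership (_≟_ {N}) using (_∈?_)

-- Counting vertices

¬T-∨ : ∀ {a b} → ¬ T a → ¬ T b → ¬ T (a ∨ b)
¬T-∨ ¬a ¬b a∨b = [ ¬a , ¬b ]′ (Equivalence.to T-∨ a∨b)

𝟙 : Bool → ℕ
𝟙 b = if b then 1 else 0

count : ∀ {N} → (Fin N → Bool) → ℕ
count {N} P = ∑[ x < N ] 𝟙 (P x)

∑-mono-≤ : ∀ {n} {f g : Fin n → ℕ} → (∀ i → f i ≤ g i) → ∑[ i < n ] f i ≤ ∑[ i < n ] g i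
∑-mono-≤ {zero}  _   = z≤n
∑-mono-≤ {suc n} f≤g = +-mono-≤ (f≤g zero) (∑-mono-≤ (f≤g ∘ suc))

sum-tabulate : ∀ {n} (f : Fin n → ℕ) → sum (tabulate f) ≡ ∑[ i < n ] f i
sum-tabulate {zero}  f = refl
sum-tabulate {suc n} f = cong (f zero +_) (sum-tabulate (f ∘ suc))

deg≡count : ∀ {N} (A : Fin N → Fin N → Bool) v → deg A v ≡ count (A v)
deg≡count {N} A v = trans (cong sum (map-tabulate {n = N} id (𝟙 ∘ A v))) (sum-tabulate (𝟙 ∘ A v))

count-cong : ∀ {N} {P Q : Fin N → Bool} → (∀ x → P x ≡ Q x) → count P ≡ count Q
count-cong P≗Q = sum-cong-≗ (cong 𝟙 ∘ P≗Q)

count-≤ : ∀ {N} {P Q : Fin N → Bool} → (∀ x → T (P x) → T (Q x)) → count P ≤ count Q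
count-≤ {P = P} {Q} P⇒Q = ∑-mono-≤ (λ x → 𝟙-mono (P x) (Q x) (P⇒Q x))
  where
  𝟙-mono : ∀ a b → (T a → T b) → 𝟙 a ≤ 𝟙 b
  𝟙-mono false _     _   = z≤n
  𝟙-mono true  true  _   = ≤-refl
  𝟙-mono true  false a⇒b = ⊥-elim (a⇒b _)

count-∨ : ∀ {N} (P Q : Fin N → Bool) → (∀ x → T (P x) → T (Q x) → ⊥) →
          count (λ x → P x ∨ Q x) ≡ count P + count Q
count-∨ P Q disjoint =
  trans (sum-cong-≗ (λ x → 𝟙-∨ (P x) (Q x) (disjoint x))) (∑-distrib-+ (𝟙 ∘ P) (𝟙 ∘ Q))
  where
  𝟙-∨ : ∀ a b → (T a → T b → ⊥) → 𝟙 (a ∨ b) ≡ 𝟙 a + 𝟙 b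
  𝟙-∨ true  true  a∧b = ⊥-elim (a∧b _ _)
  𝟙-∨ true  false _   = refl
  𝟙-∨ false _     _   = refl

count-true : ∀ {N} → count {N} (λ _ → true) ≡ N
count-true {zero}  = refl
count-true {suc N} = cong suc (count-true {N})

count-≟ : ∀ {N} (c : Fin N) → count (λ x → ⌊ x ≟ c ⌋) ≡ 1
count-≟ {suc N} zero    = cong suc (sum-replicate-zero N)
count-≟ {suc N} (suc c) = trans (count-cong ⌊suc≟suc⌋) (count-≟ c)
  where
  ⌊suc≟suc⌋ : ∀ x → ⌊ suc x ≟ suc c ⌋ ≡ ⌊ x ≟ c ⌋
  ⌊suc≟suc⌋ x = trans (isYes≗does (suc x ≟ suc c)) (sym (isYes≗does (x ≟ c)))

count-∈ : ∀ {N} {cs : List (Fin N)} → Unique cs → count (λ x → ⌊ x ∈? cs ⌋) ≡ length cs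
count-∈ {N} {[]}     []              = sum-replicate-zero N
count-∈ {N} {c ∷ cs} (c∉cs ∷ unique) = begin
  count (λ x → ⌊ x ∈? c ∷ cs ⌋)
    ≡⟨ count-cong ⌊∈∷⌋ ⟩
  count (λ x → ⌊ x ≟ c ⌋ ∨ ⌊ x ∈? cs ⌋)
    ≡⟨ count-∨ _ (λ x → ⌊ x ∈? cs ⌋) (λ x x≡c x∈cs → All.lookup c∉cs (toWitness x∈cs) (sym (toWitness x≡c))) ⟩
  count (λ x → ⌊ x ≟ c ⌋) + count (λ x → ⌊ x ∈? cs ⌋)
    ≡⟨ cong₂ _+_ (count-≟ c) (count-∈ unique) ⟩
  suc (length cs) ∎
  where
  open ≡-Reasoning
  ⌊∈∷⌋ : ∀ x → ⌊ x ∈? c ∷ cs ⌋ ≡ ⌊ x ≟ c ⌋ ∨ ⌊ x ∈? cs ⌋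
  ⌊∈∷⌋ x = trans (isYes≗does (x ∈? c ∷ cs)) (sym (cong₂ _∨_ (isYes≗does (x ≟ c)) (isYes≗does (x ∈? cs))))

count+length≤ : ∀ {N} {P : Fin N → Bool} {cs} → Unique cs → All (λ c → ¬ T (P c)) cs →
                count P + length cs ≤ N
count+length≤ {N} {P} {cs} unique outside = begin
  count P + length cs
    ≡⟨ cong (count P +_) (count-∈ unique) ⟨
  count P + count (λ x → ⌊ x ∈? cs ⌋)
    ≡⟨ count-∨ P (λ x → ⌊ x ∈? cs ⌋) (λ x Px x∈cs → All.lookup outside (toWitness x∈cs) Px) ⟨
  count (λ x → P x ∨ ⌊ x ∈? cs ⌋)
    ≤⟨ count-≤ {P = λ x → P x ∨ ⌊ x ∈? cs ⌋} {Q = λ _ → true} _ ⟩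
  count {N} (λ _ → true)
    ≡⟨ count-true ⟩
  N ∎
  where open ≤-Reasoning

∃-outside : ∀ {N} {P : Fin N → Bool} {cs} → Unique cs → length cs < count P →
            ∃ λ x → T (P x) × x ∉ cs
∃-outside {P = P} {cs} unique more with any? (λ x → T? (P x) ×-dec ¬? (x ∈? cs))
... | yes found = found
... | no  none  = contradiction (begin
  count P                    ≤⟨ count-≤ inside ⟩
  count (λ x → ⌊ x ∈? cs ⌋)  ≡⟨ count-∈ unique ⟩
  length cs                  ∎) (<⇒≱ more)
  where
  open ≤-Reasoning
  inside : ∀ x → T (P x) → T ⌊ x ∈? cs ⌋
  inside x Px = fromWitness (decidable-stable (x ∈? cs) (λ x∉cs → none (x , Px , x∉cs)))

handshake : ∀ {n} (A : Fin n → Fin n → Bool) → (∀ u v → A u v ≡ A v u) → (∀ v → A v v ≡ false) →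
            ∃ λ j → ∑[ u < n ] count (A u) ≡ 2 * j
handshake {zero}  A symmetric irreflexive = 0 , refl
handshake {suc n} A symmetric irreflexive
  with j , even ← handshake (λ u v → A (suc u) (suc v)) (λ u v → symmetric (suc u) (suc v)) (irreflexive ∘ suc)
  = X + j , (begin
    (𝟙 (A zero zero) + X) + ∑[ u < n ] (𝟙 (A (suc u) zero) + count (A (suc u) ∘ suc))
      ≡⟨ cong₂ (λ a b → (𝟙 a + X) + b) (irreflexive zero) (∑-distrib-+ (λ u → 𝟙 (A (suc u) zero)) _) ⟩
    X + (∑[ u < n ] 𝟙 (A (suc u) zero) + ∑[ u < n ] count (A (suc u) ∘ suc))
      ≡⟨ cong₂ (λ a b → X + (a + b)) (sum-cong-≗ (λ u → cong 𝟙 (symmetric (suc u) zero))) even ⟩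
    X + (X + 2 * j)
      ≡⟨ solve 2 (λ x j → x :+ (x :+ con 2 :* j) := con 2 :* (x :+ j)) refl X j ⟩
    2 * (X + j) ∎)
  where
  open ≡-Reasoning
  open +-*-Solver
  X = count (A zero ∘ suc)

-- Short wcycles and lower bounds on the order

module Edges {N : ℕ} (G : WGraph N) where

  Light Heavy Adj : Fin N → Fin N → Set
  Light x y = T (L G x y)
  Heavy x y = T (H G x y)
  Adj   x y = T (L G x y ∨ H G x y)

  light-sym : ∀ {x y} → Light x y → Light y x
  light-sym {x} {y} = subst T (L-sym G x y)

  heavy-sym : ∀ {x y} → Heavy x y → Heavy y x
  heavy-sym {x} {y} = subst T (H-sym G x y)

  light-≢ : ∀ {x y} → Light x y → x ≢ y
  light-≢ {x} l refl = subst T (L-irr G x) l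

  heavy-≢ : ∀ {x y} → Heavy x y → x ≢ y
  heavy-≢ {x} h refl = subst T (H-irr G x) h

  light⇒¬heavy : ∀ {x y} → Light x y → ¬ Heavy x y
  light⇒¬heavy {x} {y} l h = subst T (disjoint G x y) (Equivalence.from T-∧ (l , h))

  heavy-irrefl : ∀ {x} → ¬ Heavy x x
  heavy-irrefl h = heavy-≢ h refl

  adj⇒light⊎heavy : ∀ {x y} → Adj x y → Light x y ⊎ Heavy x y
  adj⇒light⊎heavy = Equivalence.to T-∨

  adj-≢ : ∀ {x y} → Adj x y → x ≢ y
  adj-≢ a = [ light-≢ , heavy-≢ ]′ (adj⇒light⊎heavy a)

  data Edge : ℕ → Fin N → Fin N → Set where
    light : ∀ {x y} → Light x y → Edge 1 x y
    heavy : ∀ {x y} → Heavy x y → Edge 2 x y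

  light⇒adj : ∀ {x y} → Light x y → Adj x y
  light⇒adj l = Equivalence.from T-∨ (inj₁ l)

  edge-adj : ∀ {w x y} → Edge w x y → Adj x y
  edge-adj (light l) = light⇒adj l
  edge-adj (heavy h) = Equivalence.from T-∨ (inj₂ h)

  edge-≢ : ∀ {w x y} → Edge w x y → x ≢ y
  edge-≢ (light l) = light-≢ l
  edge-≢ (heavy h) = heavy-≢ h

  edge-weight : ∀ {w x y} → Edge w x y → edgeWeight G x y ≡ w
  edge-weight {x = x} {y} (light l) with L G x y
  ... | true = refl
  edge-weight {x = x} {y} (heavy h) with L G x y | light⇒¬heavy {x} {y}
  ... | true  | ¬h = ⊥-elim (¬h _ h)
  ... | false | _  with H G x y
  ...   | true = refl

  triangle : ∀ {a b c x y z} → Edge a x y → Edge b y z → Edge c z x →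
             IsWCycle G (x ∷ y ∷ z ∷ []) × weight G (x ∷ y ∷ z ∷ []) ≡ a + b + c
  triangle {a} {b} {c} exy eyz ezx =
    (s≤s (s≤s (s≤s z≤n)) ,
     (edge-≢ exy ∷ ≢-sym (edge-≢ ezx) ∷ []) ∷ (edge-≢ eyz ∷ []) ∷ [] ∷ [] ,
     edge-adj exy ∷ edge-adj eyz ∷ edge-adj ezx ∷ []) ,
    trans (cong₂ _+_ (edge-weight exy) (cong₂ _+_ (edge-weight eyz) (cong (_+ 0) (edge-weight ezx))))
          (solve 3 (λ a b c → a :+ (b :+ (c :+ con 0)) := a :+ b :+ c) refl a b c)
    where open +-*-Solver

  square : ∀ {a b c d x y z w} → x ≢ z → y ≢ w → Edge a x y → Edge b y z → Edge c z w → Edge d w x →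
           IsWCycle G (x ∷ y ∷ z ∷ w ∷ []) × weight G (x ∷ y ∷ z ∷ w ∷ []) ≡ a + b + c + d
  square {a} {b} {c} {d} x≢z y≢w exy eyz ezw ewx =
    (s≤s (s≤s (s≤s z≤n)) ,
     (edge-≢ exy ∷ x≢z ∷ ≢-sym (edge-≢ ewx) ∷ []) ∷ (edge-≢ eyz ∷ y≢w ∷ []) ∷ (edge-≢ ezw ∷ []) ∷ [] ∷ [] ,
     edge-adj exy ∷ edge-adj eyz ∷ edge-adj ezw ∷ edge-adj ewx ∷ []) ,
    trans (cong₂ _+_ (edge-weight exy) (cong₂ _+_ (edge-weight eyz)
            (cong₂ _+_ (edge-weight ezw) (cong (_+ 0) (edge-weight ewx)))))
          (solve 4 (λ a b c d → a :+ (b :+ (c :+ (d :+ con 0))) := a :+ b :+ c :+ d) refl a b c d)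
    where open +-*-Solver

  pentagon : ∀ {a b c d e x y z w v} → x ≢ z → x ≢ w → y ≢ w → y ≢ v → z ≢ v →
             Edge a x y → Edge b y z → Edge c z w → Edge d w v → Edge e v x →
             IsWCycle G (x ∷ y ∷ z ∷ w ∷ v ∷ []) × weight G (x ∷ y ∷ z ∷ w ∷ v ∷ []) ≡ a + b + c + d + e
  pentagon {a} {b} {c} {d} {e} x≢z x≢w y≢w y≢v z≢v exy eyz ezw ewv evx =
    (s≤s (s≤s (s≤s z≤n)) ,
     (edge-≢ exy ∷ x≢z ∷ x≢w ∷ ≢-sym (edge-≢ evx) ∷ []) ∷ (edge-≢ eyz ∷ y≢w ∷ y≢v ∷ []) ∷
       (edge-≢ ezw ∷ z≢v ∷ []) ∷ (edge-≢ ewv ∷ []) ∷ [] ∷ [] ,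
     edge-adj exy ∷ edge-adj eyz ∷ edge-adj ezw ∷ edge-adj ewv ∷ edge-adj evx ∷ []) ,
    trans (cong₂ _+_ (edge-weight exy) (cong₂ _+_ (edge-weight eyz)
            (cong₂ _+_ (edge-weight ezw) (cong₂ _+_ (edge-weight ewv) (cong (_+ 0) (edge-weight evx))))))
          (solve 5 (λ a b c d e → a :+ (b :+ (c :+ (d :+ (e :+ con 0)))) := a :+ b :+ c :+ d :+ e) refl a b c d e)
    where open +-*-Solver

module ShortCycles {N : ℕ} (G : WGraph N) {g : ℕ} (girth≥ : ∀ xs → IsWCycle G xs → g ≤ weight G xs) where
  open Edges G

  -- At call sites with numeric weights the bound T (w <ᵇ g) is found by evaluation.
  lighter-than-girth : ∀ {xs w} → IsWCycle G xs × weight G xs ≡ w → {T (w <ᵇ g)} → ⊥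
  lighter-than-girth {xs} (cycle , refl) {lighter} = <⇒≱ (<ᵇ⇒< _ _ lighter) (girth≥ xs cycle)

  no-triangle : ∀ {a b c x y z} → Edge a x y → Edge b y z → Edge c z x → {T (a + b + c <ᵇ g)} → ⊥
  no-triangle exy eyz ezx {lighter} = lighter-than-girth (triangle exy eyz ezx) {lighter}

  no-square : ∀ {a b c d x y z w} → x ≢ z → y ≢ w →
              Edge a x y → Edge b y z → Edge c z w → Edge d w x → {T (a + b + c + d <ᵇ g)} → ⊥
  no-square x≢z y≢w exy eyz ezw ewx {lighter} = lighter-than-girth (square x≢z y≢w exy eyz ezw ewx) {lighter}

  no-pentagon : ∀ {a b c d e x y z w v} → x ≢ z → x ≢ w → y ≢ w → y ≢ v → z ≢ v →
                Edge a x y → Edge b y z → Edge c z w → Edge d w v → Edge e v x →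
                {T (a + b + c + d + e <ᵇ g)} → ⊥
  no-pentagon x≢z x≢w y≢w y≢v z≢v exy eyz ezw ewv evx {lighter} =
    lighter-than-girth (pentagon x≢z x≢w y≢w y≢v z≢v exy eyz ezw ewv evx) {lighter}

module LowerBounds {N : ℕ} (G : WGraph N) where
  open Edges G

  a-vertex : ∀ {g} → HasGirth G g → Fin N
  a-vertex ((x ∷ _ , _) , _)        = x
  a-vertex (([] , (() , _) , _) , _)

  degree-bound : ∀ v → deg (L G) v + deg (H G) v + 1 ≤ N
  degree-bound v = begin
    deg (L G) v + deg (H G) v + 1        ≡⟨ cong₂ (λ l h → l + h + 1) (deg≡count (L G) v) (deg≡count (H G) v) ⟩
    count (L G v) + count (H G v) + 1    ≡⟨ cong (_+ 1) (count-∨ (L G v) (H G v) (λ _ → light⇒¬heavy)) ⟨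
    count (λ x → L G v x ∨ H G v x) + 1  ≤⟨ count+length≤ ([] ∷ []) ((λ a → adj-≢ a refl) ∷ []) ⟩
    N                                    ∎
    where open ≤-Reasoning

  order≥b+2 : ∀ {b g} → IsRegular G 1 b → HasGirth G g → b + 2 ≤ N
  order≥b+2 {b} (1-regular , b-regular) girth = begin
    b + 2                                                  ≡⟨ +-suc b 1 ⟩
    1 + b + 1                                              ≡⟨ cong₂ (λ l h → l + h + 1) (1-regular v) (b-regular v) ⟨
    deg (L G) v + deg (H G) v + 1                          ≤⟨ degree-bound v ⟩
    N                                                      ∎
    where
    open ≤-Reasoning
    v = a-vertex girth

  order-even : ∀ {b} → IsRegular G 1 b → ∃ λ j → N ≡ 2 * j
  order-even (1-regular , _) with j , even ← handshake (L G) (L-sym G) (L-irr G) =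
    j , (begin
    N                          ≡⟨ count-true ⟨
    ∑[ u < N ] 1               ≡⟨ sum-cong-≗ (λ u → trans (sym (1-regular u)) (deg≡count (L G) u)) ⟩
    ∑[ u < N ] count (L G u)   ≡⟨ even ⟩
    2 * j                      ∎)
    where open ≡-Reasoning

  order≥b+3 : ∀ {b g k} → b ≡ 1 + 2 * k → IsRegular G 1 b → HasGirth G g → b + 3 ≤ N
  order≥b+3 {b} {k = k} refl regular girth with j , N≡2j ← order-even regular =
    subst (_≤ N) (sym (+-suc b 2)) (≤∧≢⇒< (order≥b+2 regular girth) b+2≢N)
    where
    b+2≢N : b + 2 ≢ N
    b+2≢N b+2≡N = even≢odd j (suc k) (begin
      2 * j              ≡⟨ N≡2j ⟨
      N                  ≡⟨ b+2≡N ⟨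
      suc (2 * k + 2)    ≡⟨ cong suc (+-comm (2 * k) 2) ⟩
      suc (2 + 2 * k)    ≡⟨ cong suc (*-suc 2 k) ⟨
      suc (2 * suc k)    ∎)
      where open ≡-Reasoning

  light-neighbour : ∀ {v k} → deg (L G) v ≡ suc k → ∃ (Light v)
  light-neighbour {v} d
    with x , l , _ ← ∃-outside {cs = []} [] (subst (0 <_) (trans (sym d) (deg≡count (L G) v)) (s≤s z≤n)) =
    x , l

  another-light-neighbour : ∀ {v u} → deg (L G) v ≡ 2 → Light v u → ∃ λ w → w ≢ u × Light v w
  another-light-neighbour {v} {u} d _
    with x , l , x∉[u] ← ∃-outside {cs = u ∷ []} ([] ∷ []) (subst (1 <_) (trans (sym d) (deg≡count (L G) v)) ≤-refl) =
    x , (λ x≡u → x∉[u] (here x≡u)) , l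

  module Girth≥5 (girth≥5 : ∀ xs → IsWCycle G xs → 5 ≤ weight G xs) where
    open ShortCycles G girth≥5

    light-path-unique : ∀ {x₀ x₁ x₂ x₃ x₄} → Light x₀ x₁ → Light x₁ x₂ → Light x₂ x₃ → Light x₃ x₄ →
                        x₀ ≢ x₂ → x₁ ≢ x₃ → x₂ ≢ x₄ → Unique (x₀ ∷ x₁ ∷ x₂ ∷ x₃ ∷ x₄ ∷ [])
    light-path-unique {x₀} {x₁} {x₂} {x₃} {x₄} l₀₁ l₁₂ l₂₃ l₃₄ x₀≢x₂ x₁≢x₃ x₂≢x₄ =
      (light-≢ l₀₁ ∷ x₀≢x₂ ∷ x₀≢x₃ ∷ x₀≢x₄ ∷ []) ∷ (light-≢ l₁₂ ∷ x₁≢x₃ ∷ x₁≢x₄ ∷ []) ∷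
      (light-≢ l₂₃ ∷ x₂≢x₄ ∷ []) ∷ (light-≢ l₃₄ ∷ []) ∷ [] ∷ []
      where
      x₀≢x₃ : x₀ ≢ x₃
      x₀≢x₃ e = no-triangle (light l₀₁) (light l₁₂) (light (subst (Light x₂) (sym e) l₂₃))
      x₁≢x₄ : x₁ ≢ x₄
      x₁≢x₄ e = no-triangle (light l₁₂) (light l₂₃) (light (subst (Light x₃) (sym e) l₃₄))
      x₀≢x₄ : x₀ ≢ x₄
      x₀≢x₄ e = no-square x₀≢x₂ x₁≢x₃ (light l₀₁) (light l₁₂) (light l₂₃) (light (subst (Light x₃) (sym e) l₃₄))

    order≥b+5 : ∀ {b} → IsRegular G 2 b → Fin N → b + 5 ≤ N
    order≥b+5 {b} (2-regular , b-regular) v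
      with u  , l-vu         ← light-neighbour (2-regular v)
      with w  , w≢u  , l-vw  ← another-light-neighbour (2-regular v) l-vu
      with u₁ , u₁≢v , l-uu₁ ← another-light-neighbour (2-regular u) (light-sym l-vu)
      with w₁ , w₁≢v , l-ww₁ ← another-light-neighbour (2-regular w) (light-sym l-vw) = begin
      b + 5              ≡⟨ cong (_+ 5) (trans (sym (b-regular v)) (deg≡count (H G) v)) ⟩
      count (H G v) + 5  ≤⟨ count+length≤
          (light-path-unique (light-sym l-uu₁) (light-sym l-vu) l-vw l-ww₁ u₁≢v (≢-sym w≢u) (≢-sym w₁≢v))
          ((λ h → no-triangle (light l-vu) (light l-uu₁) (heavy (heavy-sym h))) ∷
           light⇒¬heavy l-vu ∷ heavy-irrefl ∷ light⇒¬heavy l-vw ∷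
           (λ h → no-triangle (light l-vw) (light l-ww₁) (heavy (heavy-sym h))) ∷ []) ⟩
      N                  ∎
      where open ≤-Reasoning

  module Girth≥6 (girth≥6 : ∀ xs → IsWCycle G xs → 6 ≤ weight G xs) where
    open ShortCycles G girth≥6
    open Girth≥5 (λ xs cycle → ≤-trans (n≤1+n 5) (girth≥6 xs cycle)) using (light-path-unique)

    light-path-unique₆ : ∀ {x₀ x₁ x₂ x₃ x₄ x₅} →
      Light x₀ x₁ → Light x₁ x₂ → Light x₂ x₃ → Light x₃ x₄ → Light x₄ x₅ →
      x₀ ≢ x₂ → x₁ ≢ x₃ → x₂ ≢ x₄ → x₃ ≢ x₅ → Unique (x₀ ∷ x₁ ∷ x₂ ∷ x₃ ∷ x₄ ∷ x₅ ∷ [])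
    light-path-unique₆ {x₄ = x₄} l₀₁ l₁₂ l₂₃ l₃₄ l₄₅ x₀≢x₂ x₁≢x₃ x₂≢x₄ x₃≢x₅
      with (x₀≢x₁ ∷ _ ∷ x₀≢x₃ ∷ x₀≢x₄ ∷ []) ∷ (_ ∷ _ ∷ x₁≢x₄ ∷ []) ∷ _
           ← light-path-unique l₀₁ l₁₂ l₂₃ l₃₄ x₀≢x₂ x₁≢x₃ x₂≢x₄ =
      (x₀≢x₁ ∷ x₀≢x₂ ∷ x₀≢x₃ ∷ x₀≢x₄ ∷ x₀≢x₅ ∷ []) ∷ light-path-unique l₁₂ l₂₃ l₃₄ l₄₅ x₁≢x₃ x₂≢x₄ x₃≢x₅
      where
      x₀≢x₅ = λ e → no-pentagon x₀≢x₂ x₀≢x₃ x₁≢x₃ x₁≢x₄ x₂≢x₄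
                      (light l₀₁) (light l₁₂) (light l₂₃) (light l₃₄) (light (subst (Light x₄) (sym e) l₄₅))

    count-heavy-pair : ∀ {b u v} → (∀ x → deg (H G) x ≡ b) → Light u v →
                       count (λ x → H G u x ∨ H G v x) ≡ 2 * b
    count-heavy-pair {b} {u} {v} b-regular l = begin
      count (λ x → H G u x ∨ H G v x)
        ≡⟨ count-∨ (H G u) (H G v) (λ _ hu hv → no-triangle (light l) (heavy hv) (heavy (heavy-sym hu))) ⟩
      count (H G u) + count (H G v)
        ≡⟨ cong₂ _+_ (trans (sym (deg≡count (H G) u)) (b-regular u)) (trans (sym (deg≡count (H G) v)) (b-regular v)) ⟩
      b + b
        ≡⟨ cong (b +_) (+-identityʳ b) ⟨
      2 * b ∎
      where open ≡-Reasoning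

    order≥2b+2 : ∀ {b} → IsRegular G 1 b → Fin N → 2 * b + 2 ≤ N
    order≥2b+2 {b} (1-regular , b-regular) u with v , l-uv ← light-neighbour (1-regular u) = begin
      2 * b + 2                            ≡⟨ cong (_+ 2) (count-heavy-pair b-regular l-uv) ⟨
      count (λ x → H G u x ∨ H G v x) + 2  ≤⟨ count+length≤ ((light-≢ l-uv ∷ []) ∷ [] ∷ [])
                                                (¬T-∨ heavy-irrefl (light⇒¬heavy (light-sym l-uv)) ∷
                                                 ¬T-∨ (light⇒¬heavy l-uv) heavy-irrefl ∷ []) ⟩
      N                                    ∎
      where open ≤-Reasoning

    no-heavy-along : ∀ {x y y₁ y₂} → Light x y → Light y y₁ → Light y₁ y₂ → x ≢ y₁ → y ≢ y₂ →
                     (¬ Heavy x y₁ × ¬ Heavy y y₁) × (¬ Heavy x y₂ × ¬ Heavy y y₂)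
    no-heavy-along l l₁ l₂ x≢y₁ y≢y₂ =
      ((λ h → no-triangle (light l) (light l₁) (heavy (heavy-sym h))) , light⇒¬heavy l₁) ,
      ((λ h → no-square x≢y₁ y≢y₂ (light l) (light l₁) (light l₂) (heavy (heavy-sym h))) ,
       (λ h → no-triangle (light l₁) (light l₂) (heavy (heavy-sym h))))

    order≥2b+6 : ∀ {b} → IsRegular G 2 b → Fin N → 2 * b + 6 ≤ N
    order≥2b+6 {b} (2-regular , b-regular) u
      with v  , l-uv           ← light-neighbour (2-regular u)
      with u₁ , u₁≢v , l-uu₁   ← another-light-neighbour (2-regular u) l-uv
      with v₁ , v₁≢u , l-vv₁   ← another-light-neighbour (2-regular v) (light-sym l-uv)
      with u₂ , u₂≢u , l-u₁u₂  ← another-light-neighbour (2-regular u₁) (light-sym l-uu₁)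
      with v₂ , v₂≢v , l-v₁v₂  ← another-light-neighbour (2-regular v₁) (light-sym l-vv₁)
      with (¬Hvu₁ , ¬Huu₁) , (¬Hvu₂ , ¬Huu₂) ← no-heavy-along (light-sym l-uv) l-uu₁ l-u₁u₂ (≢-sym u₁≢v) (≢-sym u₂≢u)
      with (¬Huv₁ , ¬Hvv₁) , (¬Huv₂ , ¬Hvv₂) ← no-heavy-along l-uv l-vv₁ l-v₁v₂ (≢-sym v₁≢u) (≢-sym v₂≢v) = begin
      2 * b + 6                            ≡⟨ cong (_+ 6) (count-heavy-pair b-regular l-uv) ⟨
      count (λ x → H G u x ∨ H G v x) + 6  ≤⟨ count+length≤
          (light-path-unique₆ (light-sym l-u₁u₂) (light-sym l-uu₁) l-uv l-vv₁ l-v₁v₂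
                              u₂≢u u₁≢v (≢-sym v₁≢u) (≢-sym v₂≢v))
          (¬T-∨ ¬Huu₂ ¬Hvu₂ ∷ ¬T-∨ ¬Huu₁ ¬Hvu₁ ∷ ¬T-∨ heavy-irrefl (light⇒¬heavy (light-sym l-uv)) ∷
           ¬T-∨ (light⇒¬heavy l-uv) heavy-irrefl ∷ ¬T-∨ ¬Huv₁ ¬Hvv₁ ∷ ¬T-∨ ¬Huv₂ ¬Hvv₂ ∷ []) ⟩
      N                                    ∎
      where open ≤-Reasoning

  order≥b+5 : ∀ {b} → IsRegular G 2 b → HasGirth G 5 → b + 5 ≤ N
  order≥b+5 regular girth = Girth≥5.order≥b+5 (proj₂ girth) regular (a-vertex girth)

  order≥2b+2 : ∀ {b} → IsRegular G 1 b → HasGirth G 6 → 2 * b + 2 ≤ N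
  order≥2b+2 regular girth = Girth≥6.order≥2b+2 (proj₂ girth) regular (a-vertex girth)

  order≥2b+6 : ∀ {b} → IsRegular G 2 b → HasGirth G 6 → 2 * b + 6 ≤ N
  order≥2b+6 regular girth = Girth≥6.order≥2b+6 (proj₂ girth) regular (a-vertex girth)

-- Girth criteria

cost : Bool → ℕ
cost l = if l then 1 else 2

length≤∑cost : ∀ bs → length bs ≤ sum (map cost bs)
length≤∑cost []          = z≤n
length≤∑cost (true ∷ bs)  = s≤s (length≤∑cost bs)
length≤∑cost (false ∷ bs) = s≤s (≤-trans (length≤∑cost bs) (n≤1+n _))

not-all-light : ∀ bs → ¬ All T bs → suc (length bs) ≤ sum (map cost bs)
not-all-light []           notAll = ⊥-elim (notAll [])
not-all-light (true ∷ bs)  notAll = s≤s (not-all-light bs (notAll ∘ (_ ∷_)))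
not-all-light (false ∷ bs) _      = s≤s (s≤s (length≤∑cost bs))

at-most-one-light : ∀ a b c → (T a → T b → ⊥) → (T b → T c → ⊥) → (T c → T a → ⊥) →
                    5 ≤ sum (map cost (a ∷ b ∷ c ∷ []))
at-most-one-light true  true  _     ab _  _  = ⊥-elim (ab _ _)
at-most-one-light _     true  true  _  bc _  = ⊥-elim (bc _ _)
at-most-one-light true  _     true  _  _  ca = ⊥-elim (ca _ _)
at-most-one-light true  false false _  _  _  = ≤ᵇ⇒≤ _ _ _
at-most-one-light false true  false _  _  _  = ≤ᵇ⇒≤ _ _ _
at-most-one-light false false true  _  _  _  = ≤ᵇ⇒≤ _ _ _
at-most-one-light false false false _  _  _  = ≤ᵇ⇒≤ _ _ _

at-most-two-light : ∀ a b c d → (T a → T b → T c → ⊥) → (T b → T c → T d → ⊥) → (T c → T d → T a → ⊥) →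
                    (T d → T a → T b → ⊥) → 6 ≤ sum (map cost (a ∷ b ∷ c ∷ d ∷ []))
at-most-two-light true  true  true  _     abc _   _   _   = ⊥-elim (abc _ _ _)
at-most-two-light _     true  true  true  _   bcd _   _   = ⊥-elim (bcd _ _ _)
at-most-two-light true  _     true  true  _   _   cda _   = ⊥-elim (cda _ _ _)
at-most-two-light true  true  _     true  _   _   _   dab = ⊥-elim (dab _ _ _)
at-most-two-light true  true  false false _   _   _   _   = ≤ᵇ⇒≤ _ _ _
at-most-two-light true  false true  false _   _   _   _   = ≤ᵇ⇒≤ _ _ _
at-most-two-light true  false false true  _   _   _   _   = ≤ᵇ⇒≤ _ _ _
at-most-two-light true  false false false _   _   _   _   = ≤ᵇ⇒≤ _ _ _
at-most-two-light false true  true  false _   _   _   _   = ≤ᵇ⇒≤ _ _ _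
at-most-two-light false true  false true  _   _   _   _   = ≤ᵇ⇒≤ _ _ _
at-most-two-light false true  false false _   _   _   _   = ≤ᵇ⇒≤ _ _ _
at-most-two-light false false true  true  _   _   _   _   = ≤ᵇ⇒≤ _ _ _
at-most-two-light false false true  false _   _   _   _   = ≤ᵇ⇒≤ _ _ _
at-most-two-light false false false true  _   _   _   _   = ≤ᵇ⇒≤ _ _ _
at-most-two-light false false false false _   _   _   _   = ≤ᵇ⇒≤ _ _ _

no-light : ∀ a b c → ¬ T a → ¬ T b → ¬ T c → 6 ≤ sum (map cost (a ∷ b ∷ c ∷ []))
no-light true  _     _     ¬a _  _  = ⊥-elim (¬a _)
no-light _     true  _     _  ¬b _  = ⊥-elim (¬b _)
no-light _     _     true  _  _  ¬c = ⊥-elim (¬c _)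
no-light false false false _  _  _  = ≤-refl

length-cycleEdges : ∀ {A : Set} (xs : List A) → length (cycleEdges xs) ≡ length xs
length-cycleEdges []       = refl
length-cycleEdges (x ∷ xs) = trans (length-consec x (xs ++ [ x ])) (trans (length-++ xs) (+-comm (length xs) 1))
  where
  length-consec : ∀ {A : Set} (x : A) ys → length (consec (x ∷ ys)) ≡ length ys
  length-consec x []       = refl
  length-consec x (y ∷ ys) = cong suc (length-consec y ys)

module GirthCriteria {N : ℕ} (G : WGraph N) where
  open Edges G

  lightness : List (Fin N) → List Bool
  lightness xs = map (λ e → L G (proj₁ e) (proj₂ e)) (cycleEdges xs)

  weight≡∑cost : ∀ {xs} → IsWCycle G xs → weight G xs ≡ sum (map cost (lightness xs))
  weight≡∑cost {xs} (_ , _ , adjacent) = go (cycleEdges xs) adjacent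
    where
    edge-cost : ∀ {x y} → Adj x y → edgeWeight G x y ≡ cost (L G x y)
    edge-cost {x} {y} a with L G x y | H G x y
    ... | true  | _    = refl
    ... | false | true = refl
    go : ∀ es → All (λ e → Adj (proj₁ e) (proj₂ e)) es →
         sum (map (λ e → edgeWeight G (proj₁ e) (proj₂ e)) es) ≡
         sum (map cost (map (λ e → L G (proj₁ e) (proj₂ e)) es))
    go []       []       = refl
    go (_ ∷ es) (a ∷ as) = cong₂ _+_ (edge-cost a) (go es as)

  length≤weight : ∀ {xs} → IsWCycle G xs → length xs ≤ weight G xs
  length≤weight {xs} cycle = begin
    length xs                       ≡⟨ trans (length-map _ (cycleEdges xs)) (length-cycleEdges xs) ⟨
    length (lightness xs)           ≤⟨ length≤∑cost (lightness xs) ⟩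
    sum (map cost (lightness xs))   ≡⟨ weight≡∑cost cycle ⟨
    weight G xs                     ∎
    where open ≤-Reasoning

  girth≥5 : (∀ {x y z} → Light x y → Light y z → x ≢ z → ¬ Adj z x) →
            (∀ {x y z w} → Light x y → Light y z → Light z w → Light w x → x ≢ z → y ≢ w → ⊥) →
            ∀ xs → IsWCycle G xs → 5 ≤ weight G xs
  girth≥5 _ _ []              (() , _)
  girth≥5 _ _ (_ ∷ [])         (s≤s () , _)
  girth≥5 _ _ (_ ∷ _ ∷ [])     (s≤s (s≤s ()) , _)
  girth≥5 no-light-cherry _ (x ∷ y ∷ z ∷ []) cycle@(_ , (x≢y ∷ x≢z ∷ []) ∷ (y≢z ∷ []) ∷ _ , axy ∷ ayz ∷ azx ∷ []) =
    subst (5 ≤_) (sym (weight≡∑cost cycle)) (at-most-one-light (L G x y) (L G y z) (L G z x)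
      (λ lxy lyz → no-light-cherry lxy lyz x≢z azx)
      (λ lyz lzx → no-light-cherry lyz lzx (≢-sym x≢y) axy)
      (λ lzx lxy → no-light-cherry lzx lxy (≢-sym y≢z) ayz))
  girth≥5 _ no-light-square (x ∷ y ∷ z ∷ w ∷ []) cycle@(_ , (_ ∷ x≢z ∷ _ ∷ []) ∷ (_ ∷ y≢w ∷ []) ∷ _ , _) =
    subst (5 ≤_) (sym (weight≡∑cost cycle)) (not-all-light (lightness (x ∷ y ∷ z ∷ w ∷ []))
      (λ { (lxy ∷ lyz ∷ lzw ∷ lwx ∷ []) → no-light-square lxy lyz lzw lwx x≢z y≢w }))
  girth≥5 _ _ (_ ∷ _ ∷ _ ∷ _ ∷ _ ∷ _) cycle = ≤-trans (s≤s (s≤s (s≤s (s≤s (s≤s z≤n))))) (length≤weight cycle)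

  girth≥6 : (∀ {x y z} → Light x y → Adj y z → Adj z x → ⊥) →
            (∀ {x y z w} → Light x y → Light y z → Light z w → Adj w x → x ≢ z → y ≢ w → ⊥) →
            (∀ {x y z w v} → Light x y → Light y z → Light z w → Light w v → Light v x → ⊥) →
            ∀ xs → IsWCycle G xs → 6 ≤ weight G xs
  girth≥6 _ _ _ []              (() , _)
  girth≥6 _ _ _ (_ ∷ [])         (s≤s () , _)
  girth≥6 _ _ _ (_ ∷ _ ∷ [])     (s≤s (s≤s ()) , _)
  girth≥6 no-light-triangle _ _ (x ∷ y ∷ z ∷ []) cycle@(_ , _ , axy ∷ ayz ∷ azx ∷ []) =
    subst (6 ≤_) (sym (weight≡∑cost cycle)) (no-light (L G x y) (L G y z) (L G z x)
      (λ lxy → no-light-triangle lxy ayz azx)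
      (λ lyz → no-light-triangle lyz azx axy)
      (λ lzx → no-light-triangle lzx axy ayz))
  girth≥6 _ no-light-path₃ _ (x ∷ y ∷ z ∷ w ∷ [])
          cycle@(_ , (_ ∷ x≢z ∷ _ ∷ []) ∷ (_ ∷ y≢w ∷ []) ∷ _ , axy ∷ ayz ∷ azw ∷ awx ∷ []) =
    subst (6 ≤_) (sym (weight≡∑cost cycle)) (at-most-two-light (L G x y) (L G y z) (L G z w) (L G w x)
      (λ lxy lyz lzw → no-light-path₃ lxy lyz lzw awx x≢z y≢w)
      (λ lyz lzw lwx → no-light-path₃ lyz lzw lwx axy y≢w (≢-sym x≢z))
      (λ lzw lwx lxy → no-light-path₃ lzw lwx lxy ayz (≢-sym x≢z) (≢-sym y≢w))
      (λ lwx lxy lyz → no-light-path₃ lwx lxy lyz azw (≢-sym y≢w) x≢z))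
  girth≥6 _ _ no-light-pentagon (x ∷ y ∷ z ∷ w ∷ v ∷ []) cycle =
    subst (6 ≤_) (sym (weight≡∑cost cycle)) (not-all-light (lightness (x ∷ y ∷ z ∷ w ∷ v ∷ []))
      (λ { (lxy ∷ lyz ∷ lzw ∷ lwv ∷ lvx ∷ []) → no-light-pentagon lxy lyz lzw lwv lvx }))
  girth≥6 _ _ _ (_ ∷ _ ∷ _ ∷ _ ∷ _ ∷ _ ∷ _) cycle =
    ≤-trans (s≤s (s≤s (s≤s (s≤s (s≤s (s≤s z≤n)))))) (length≤weight cycle)

  Matching : Set
  Matching = ∀ {x y z} → Light x y → Light x z → y ≡ z

  matching⇒girth≥5 : Matching → ∀ xs → IsWCycle G xs → 5 ≤ weight G xs
  matching⇒girth≥5 matching = girth≥5 (λ lxy lyz x≢z _ → x≢z (matching (light-sym lxy) lyz))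
                                      (λ lxy lyz _ _ x≢z _ → x≢z (matching (light-sym lxy) lyz))

  bipartite-matching⇒girth≥6 : Matching → (colour : Fin N → Bool) → (∀ {x y} → Adj x y → colour y ≡ not (colour x)) →
                               ∀ xs → IsWCycle G xs → 6 ≤ weight G xs
  bipartite-matching⇒girth≥6 matching colour flip = girth≥6
    (λ lxy ayz azx → odd (trans (flip azx) (trans (cong not (trans (flip ayz) (cong not (flip (light⇒adj lxy)))))
                                                  (not-involutive _))))
    (λ lxy lyz _ _ x≢z _ → x≢z (matching (light-sym lxy) lyz))
    (λ lxy lyz lzw lwv lvx → odd (trans (flip (light⇒adj lvx))
                                        (cong not (trans (flip² (light⇒adj lzw) (light⇒adj lwv))
                                                         (flip² (light⇒adj lxy) (light⇒adj lyz))))))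
    where
    odd : ∀ {a} → a ≡ not a → ⊥
    odd = not-¬ refl
    flip² : ∀ {x y z} → Adj x y → Adj y z → colour z ≡ colour x
    flip² axy ayz = trans (flip ayz) (trans (cong not (flip axy)) (not-involutive _))

-- Wgraphs presented by neighbour lists

⌊⌋-cong : ∀ {A B : Set} (a? : Dec A) (b? : Dec B) → (A → B) → (B → A) → ⌊ a? ⌋ ≡ ⌊ b? ⌋
⌊⌋-cong a? b? A⇒B B⇒A = trans (isYes≗does a?) (trans (does-⇔ (mk⇔ A⇒B B⇒A) a? b?) (sym (isYes≗does b?)))

⌊⌋-true : ∀ {A : Set} (a? : Dec A) → A → ⌊ a? ⌋ ≡ true
⌊⌋-true a? a = trans (isYes≗does a?) (dec-true a? a)

⌊⌋-false : ∀ {A : Set} (a? : Dec A) → ¬ A → ⌊ a? ⌋ ≡ false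
⌊⌋-false a? ¬a = trans (isYes≗does a?) (dec-false a? ¬a)

record Presentation (N : ℕ) : Set where
  field
    light            : Fin N → List (Fin N)
    allowed          : Fin N → Fin N → Bool
    excluded         : Fin N → List (Fin N)
    light-sym        : ∀ {x y} → y ∈ light x → x ∈ light y
    light-irrefl     : ∀ x → x ∉ light x
    light-unique     : ∀ x → Unique (light x)
    allowed-sym      : ∀ x y → allowed x y ≡ allowed y x
    excluded-sym     : ∀ {x y} → y ∈ excluded x → x ∈ excluded y
    excluded-unique  : ∀ x → Unique (excluded x)
    excluded-allowed : ∀ x → All (T ∘ allowed x) (excluded x)
    self-excluded    : ∀ x → T (allowed x x) → x ∈ excluded x
    light-excluded   : ∀ {x y} → y ∈ light x → T (allowed x y) → y ∈ excluded x

  wgraph : WGraph N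
  wgraph = record
    { L        = λ x y → ⌊ y ∈? light x ⌋
    ; H        = λ x y → allowed x y ∧ not ⌊ y ∈? excluded x ⌋
    ; L-sym    = λ x y → ⌊⌋-cong (y ∈? light x) (x ∈? light y) light-sym light-sym
    ; H-sym    = λ x y → cong₂ (λ a e → a ∧ not e) (allowed-sym x y)
                                 (⌊⌋-cong (y ∈? excluded x) (x ∈? excluded y) excluded-sym excluded-sym)
    ; L-irr    = λ x → ⌊⌋-false (x ∈? light x) (light-irrefl x)
    ; H-irr    = H-irreflexive
    ; disjoint = L-H-disjoint
    }
    where
    H-irreflexive : ∀ x → allowed x x ∧ not ⌊ x ∈? excluded x ⌋ ≡ false
    H-irreflexive x with allowed x x in e
    ... | false = refl
    ... | true  = cong not (⌊⌋-true (x ∈? excluded x) (self-excluded x (subst T (sym e) _)))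
    L-H-disjoint : ∀ x y → ⌊ y ∈? light x ⌋ ∧ (allowed x y ∧ not ⌊ y ∈? excluded x ⌋) ≡ false
    L-H-disjoint x y with y ∈? light x | allowed x y in e
    ... | no  _ | _     = refl
    ... | yes _ | false = refl
    ... | yes l | true  = cong not (⌊⌋-true (y ∈? excluded x) (light-excluded l (subst T (sym e) _)))

  light-degree : ∀ x → deg (L wgraph) x ≡ length (light x)
  light-degree x = trans (deg≡count (L wgraph) x) (count-∈ (light-unique x))

  heavy-degree : ∀ x → deg (H wgraph) x + length (excluded x) ≡ count (allowed x)
  heavy-degree x = begin
    deg (H wgraph) x + length (excluded x)
      ≡⟨ cong₂ _+_ (deg≡count (H wgraph) x) (sym (count-∈ (excluded-unique x))) ⟩
    count (H wgraph x) + count (λ y → ⌊ y ∈? excluded x ⌋)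
      ≡⟨ count-∨ (H wgraph x) (λ y → ⌊ y ∈? excluded x ⌋) (λ y → ¬both (allowed x y) ⌊ y ∈? excluded x ⌋) ⟨
    count (λ y → H wgraph x y ∨ ⌊ y ∈? excluded x ⌋)
      ≡⟨ count-cong (λ y → absorb (allowed x y) (y ∈? excluded x) (All.lookup (excluded-allowed x))) ⟩
    count (allowed x) ∎
    where
    open ≡-Reasoning
    ¬both : ∀ a e → T (a ∧ not e) → T e → ⊥
    ¬both true  true  () _
    ¬both false _     () _
    absorb : ∀ a {E : Set} (e? : Dec E) → (E → T a) → (a ∧ not ⌊ e? ⌋) ∨ ⌊ e? ⌋ ≡ a
    absorb a (no _)  _   = trans (∨-identityʳ _) (∧-identityʳ a)
    absorb a (yes e) e⇒a = trans (∨-zeroʳ _) (sym (Equivalence.to T-≡ (e⇒a e)))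

wcycle? : ∀ {N} (G : WGraph N) xs → Dec (IsWCycle G xs)
wcycle? G xs = 3 ≤? length xs ×-dec allPairs? (λ x y → ¬? (x ≟ y)) xs ×-dec
               All.all? (λ e → T? (L G (proj₁ e) (proj₂ e) ∨ H G (proj₁ e) (proj₂ e))) (cycleEdges xs)

hasGirth : ∀ {N} (G : WGraph N) {g} xs → {True (wcycle? G xs)} → weight G xs ≡ g →
           (∀ ys → IsWCycle G ys → g ≤ weight G ys) → HasGirth G g
hasGirth G xs {cycle} w≡g girth≥ = (xs , toWitness cycle , w≡g) , girth≥

-- Matchings and cycles on Fin

Displaced : ℕ → ℕ → ℕ → Set
Displaced d a b = b ≡ a + d ⊎ a ≡ b + d

displaced-unique : ∀ {d e a b} → Displaced d a b → Displaced e a b → d ≡ e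
displaced-unique {d} {e} {a} {b} (inj₁ p) (inj₁ q) = +-cancelˡ-≡ a d e (trans (sym p) q)
displaced-unique {d} {e} {a} {b} (inj₂ p) (inj₂ q) = +-cancelˡ-≡ b d e (trans (sym p) q)
displaced-unique {d} {e} {a} {b} (inj₁ p) (inj₂ q) = trans (m+n≡0⇒m≡0 d d+e≡0) (sym (m+n≡0⇒n≡0 d d+e≡0))
  where
  d+e≡0 : d + e ≡ 0
  d+e≡0 = +-cancelˡ-≡ a (d + e) 0
            (trans (sym (+-assoc a d e)) (trans (cong (_+ e) (sym p)) (trans (sym q) (sym (+-identityʳ a)))))
displaced-unique (inj₂ p) (inj₁ q) = sym (displaced-unique (inj₁ q) (inj₂ p))

double : ℕ → ℕ
double zero    = zero
double (suc m) = suc (suc (double m))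

double≡+ : ∀ m → double m ≡ m + m
double≡+ zero    = refl
double≡+ (suc m) = cong suc (trans (cong suc (double≡+ m)) (sym (+-suc m m)))

double≡2* : ∀ m → double m ≡ 2 * m
double≡2* zero    = refl
double≡2* (suc m) = trans (cong (2 +_) (double≡2* m)) (sym (*-suc 2 m))

double-suc : ∀ m → double (suc m) ≡ 2 * m + 2
double-suc m = trans (cong (2 +_) (double≡2* m)) (+-comm 2 (2 * m))

isEven : ℕ → Bool
isEven zero    = true
isEven (suc n) = not (isEven n)

isEven-+-double : ∀ a m → isEven (a + double m) ≡ isEven a
isEven-+-double a zero    = cong isEven (+-identityʳ a)
isEven-+-double a (suc m) = trans (cong isEven (trans (+-suc a (suc (double m))) (cong suc (+-suc a (double m)))))
                                  (trans (not-involutive _) (isEven-+-double a m))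

parity : ∀ {n} → Fin n → Bool
parity x = isEven (toℕ x)

mate : ∀ {m} → Fin (double m) → Fin (double m)
mate {suc m} zero          = suc zero
mate {suc m} (suc zero)    = zero
mate {suc m} (suc (suc x)) = suc (suc (mate x))

mate-involutive : ∀ {m} (x : Fin (double m)) → mate (mate x) ≡ x
mate-involutive {suc m} zero          = refl
mate-involutive {suc m} (suc zero)    = refl
mate-involutive {suc m} (suc (suc x)) = cong (λ y → suc (suc y)) (mate-involutive x)

mate-displaced : ∀ {m} (x : Fin (double m)) → Displaced 1 (toℕ x) (toℕ (mate x))
mate-displaced {suc m} zero          = inj₁ refl
mate-displaced {suc m} (suc zero)    = inj₂ refl
mate-displaced {suc m} (suc (suc x)) = Sum.map (cong (2 +_)) (cong (2 +_)) (mate-displaced x)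

mate-≢ : ∀ {m} (x : Fin (double m)) → mate x ≢ x
mate-≢ x mx≡x with () ← displaced-unique (mate-displaced x) (inj₁ (trans (cong toℕ mx≡x) (sym (+-identityʳ (toℕ x)))))

parity-mate : ∀ {m} (x : Fin (double m)) → parity (mate x) ≡ not (parity x)
parity-mate {suc m} zero          = refl
parity-mate {suc m} (suc zero)    = refl
parity-mate {suc m} (suc (suc x)) = cong (not ∘ not) (parity-mate x)

count-parity : ∀ m c → count {double m} (λ y → c xor parity y) ≡ m
count-parity zero    c = refl
count-parity (suc m) c = begin
  𝟙 (c xor true) + (𝟙 (c xor false) + count {double m} (λ y → c xor not (not (parity y))))
    ≡⟨ +-assoc (𝟙 (c xor true)) (𝟙 (c xor false)) _ ⟨
  𝟙 (c xor true) + 𝟙 (c xor false) + count {double m} (λ y → c xor not (not (parity y)))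
    ≡⟨ cong₂ _+_ (one-of-two c) (count-cong {double m} (λ y → cong (c xor_) (not-involutive (parity y)))) ⟩
  1 + count {double m} (λ y → c xor parity y)
    ≡⟨ cong suc (count-parity m c) ⟩
  suc m ∎
  where
  open ≡-Reasoning
  one-of-two : ∀ c → 𝟙 (c xor true) + 𝟙 (c xor false) ≡ 1
  one-of-two true  = refl
  one-of-two false = refl

mate-light-sym : ∀ {m} {x y : Fin (double m)} → y ∈ mate x ∷ [] → x ∈ mate y ∷ []
mate-light-sym {x = x} (here refl) = here (sym (mate-involutive x))

mate-light-irrefl : ∀ {m} (x : Fin (double m)) → x ∉ mate x ∷ []
mate-light-irrefl x (here x≡mx) = mate-≢ x (sym x≡mx)

mate-light : ∀ {m} {x y : Fin (double m)} → y ∈ mate x ∷ [] → y ≡ mate x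
mate-light (here y≡mx) = y≡mx

module _ {n : ℕ} where

  rotate : ℕ → Fin (suc n) → Fin (suc n)
  rotate k x = fromℕ< (m%n<n (toℕ x + k) (suc n))

  toℕ-rotate : ∀ k x → toℕ (rotate k x) ≡ (toℕ x + k) % suc n
  toℕ-rotate k x = toℕ-fromℕ< (m%n<n (toℕ x + k) (suc n))

  rotate-rotate : ∀ j k x → rotate j (rotate k x) ≡ rotate (k + j) x
  rotate-rotate j k x = toℕ-injective (begin
    toℕ (rotate j (rotate k x))           ≡⟨ toℕ-rotate j (rotate k x) ⟩
    (toℕ (rotate k x) + j) % suc n        ≡⟨ cong (λ r → (r + j) % suc n) (toℕ-rotate k x) ⟩
    ((toℕ x + k) % suc n + j) % suc n     ≡⟨ %-distribˡ-+ ((toℕ x + k) % suc n) j (suc n) ⟩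
    ((toℕ x + k) % suc n % suc n + j % suc n) % suc n
                                          ≡⟨ cong (λ r → (r + j % suc n) % suc n) (m%n%n≡m%n (toℕ x + k) (suc n)) ⟩
    ((toℕ x + k) % suc n + j % suc n) % suc n ≡⟨ %-distribˡ-+ (toℕ x + k) j (suc n) ⟨
    (toℕ x + k + j) % suc n               ≡⟨ cong (_% suc n) (+-assoc (toℕ x) k j) ⟩
    (toℕ x + (k + j)) % suc n             ≡⟨ toℕ-rotate (k + j) x ⟨
    toℕ (rotate (k + j) x)                ∎)
    where open ≡-Reasoning

  rotate-cases : ∀ k x → k ≤ suc n →
                 toℕ (rotate k x) ≡ toℕ x + k ⊎ toℕ (rotate k x) + suc n ≡ toℕ x + k
  rotate-cases k x k≤N with toℕ x + k <? suc n
  ... | yes small = inj₁ (trans (toℕ-rotate k x) (m<n⇒m%n≡m small))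
  ... | no  large = inj₂ (begin
    toℕ (rotate k x) + suc n                  ≡⟨ cong (_+ suc n) (toℕ-rotate k x) ⟩
    (toℕ x + k) % suc n + suc n               ≡⟨ cong (_+ suc n) (m≤n⇒[n∸m]%m≡n%m N≤x+k) ⟨
    (toℕ x + k ∸ suc n) % suc n + suc n       ≡⟨ cong (_+ suc n) (m<n⇒m%n≡m x+k∸N<N) ⟩
    toℕ x + k ∸ suc n + suc n                 ≡⟨ m∸n+n≡m N≤x+k ⟩
    toℕ x + k                                 ∎)
    where
    open ≡-Reasoning
    N≤x+k = ≮⇒≥ large
    x+k∸N<N : toℕ x + k ∸ suc n < suc n
    x+k∸N<N = m<n+o⇒m∸n<o (toℕ x + k) (suc n) (+-mono-<-≤ (toℕ<n x) k≤N)

  rotate-zero : ∀ x → rotate 0 x ≡ x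
  rotate-zero x = toℕ-injective
    (trans (toℕ-rotate 0 x) (trans (cong (_% suc n) (+-identityʳ (toℕ x))) (m<n⇒m%n≡m (toℕ<n x))))

  rotate-full : ∀ x → rotate (suc n) x ≡ x
  rotate-full x = toℕ-injective
    (trans (toℕ-rotate (suc n) x) (trans ([m+n]%n≡m%n (toℕ x) (suc n)) (m<n⇒m%n≡m (toℕ<n x))))

  rotate-≢ : ∀ {k} x → 0 < k → k < suc n → rotate k x ≢ x
  rotate-≢ {k} x 0<k k<N rx≡x with rotate-cases k x (<⇒≤ k<N)
  ... | inj₁ p = <⇒≢ 0<k (sym (+-cancelˡ-≡ (toℕ x) k 0
                   (trans (sym p) (trans (cong toℕ rx≡x) (sym (+-identityʳ (toℕ x)))))))
  ... | inj₂ p = <⇒≢ k<N (sym (+-cancelˡ-≡ (toℕ x) (suc n) k (trans (cong (_+ suc n) (sym (cong toℕ rx≡x))) p)))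

  next : Fin (suc n) → Fin (suc n)
  next = rotate 1

  -- Unlike rotate n, prev computes on numerals, so the witness wcycles below
  -- are checked by evaluation.
  prev : Fin (suc n) → Fin (suc n)
  prev zero    = fromℕ n
  prev (suc x) = inject₁ x

  prev≡rotate : ∀ x → prev x ≡ rotate n x
  prev≡rotate zero    = toℕ-injective (trans (toℕ-fromℕ n) (sym (trans (toℕ-rotate n zero) (m<n⇒m%n≡m ≤-refl))))
  prev≡rotate (suc x) = toℕ-injective (begin
    toℕ (inject₁ x)              ≡⟨ toℕ-inject₁ x ⟩
    toℕ x                        ≡⟨ m<n⇒m%n≡m (m<n⇒m<1+n (toℕ<n x)) ⟨
    toℕ x % suc n                ≡⟨ [m+n]%n≡m%n (toℕ x) (suc n) ⟨
    (toℕ x + suc n) % suc n      ≡⟨ cong (_% suc n) (+-suc (toℕ x) n) ⟩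
    (suc (toℕ x) + n) % suc n    ≡⟨ toℕ-rotate n (suc x) ⟨
    toℕ (rotate n (suc x))       ∎)
    where open ≡-Reasoning

  next-prev : ∀ x → next (prev x) ≡ x
  next-prev x = trans (cong next (prev≡rotate x))
                      (trans (rotate-rotate 1 n x) (trans (cong (λ k → rotate k x) (+-comm n 1)) (rotate-full x)))

  prev-next : ∀ x → prev (next x) ≡ x
  prev-next x = trans (prev≡rotate (next x)) (trans (rotate-rotate n 1 x) (rotate-full x))

  next-injective : ∀ {x y} → next x ≡ next y → x ≡ y
  next-injective {x} {y} e = trans (sym (prev-next x)) (trans (cong prev e) (prev-next y))

  iterate-next-≢ : ∀ {j k} z → j < k → k < suc n → iterate next z j ≢ iterate next z k
  iterate-next-≢ {j} {k} z j<k k<N e = rotate-≢ (rotate j z) (m<n⇒0<n∸m j<k) (≤-<-trans (m∸n≤m k j) k<N) (begin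
    rotate (k ∸ j) (rotate j z)   ≡⟨ rotate-rotate (k ∸ j) j z ⟩
    rotate (j + (k ∸ j)) z        ≡⟨ cong (λ i → rotate i z) (m+[n∸m]≡n (<⇒≤ j<k)) ⟩
    rotate k z                    ≡⟨ iterate-next k z ⟨
    iterate next z k              ≡⟨ e ⟨
    iterate next z j              ≡⟨ iterate-next j z ⟩
    rotate j z                    ∎)
    where
    open ≡-Reasoning
    iterate-next : ∀ k x → iterate next x k ≡ rotate k x
    iterate-next zero    x = sym (rotate-zero x)
    iterate-next (suc k) x = trans (iterate-next k (next x)) (rotate-rotate k 1 x)

  parity-next : ∀ {m} → suc n ≡ double m → ∀ x → parity (next x) ≡ not (parity x)
  parity-next {m} N≡2m x = trans parity-x+1 (cong isEven (+-comm (toℕ x) 1))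
    where
    parity-x+1 : isEven (toℕ (next x)) ≡ isEven (toℕ x + 1)
    parity-x+1 with rotate-cases 1 x (s≤s z≤n)
    ... | inj₁ p = cong isEven p
    ... | inj₂ p = trans (sym (isEven-+-double (toℕ (next x)) m))
                         (cong isEven (trans (cong (toℕ (next x) +_) (sym N≡2m)) p))

module Walks {V : Set} (s : V → V) (s-injective : ∀ {x y} → s x ≡ s y → x ≡ y) where

  Step Apart₂ Apart₃ : V → V → Set
  Step   x y = y ≡ s x ⊎ x ≡ s y
  Apart₂ x y = y ≡ s (s x) ⊎ x ≡ s (s y)
  Apart₃ x y = y ≡ s (s (s x)) ⊎ x ≡ s (s (s y))

  private
    forward : ∀ {x y z} → y ≡ s x → Step y z → x ≢ z → z ≡ s y
    forward refl (inj₁ z≡sy)  _   = z≡sy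
    forward refl (inj₂ sx≡sz) x≢z = ⊥-elim (x≢z (s-injective sx≡sz))

    backward : ∀ {x y z} → x ≡ s y → Step y z → x ≢ z → y ≡ s z
    backward refl (inj₁ z≡sy) x≢z = ⊥-elim (x≢z (sym z≡sy))
    backward refl (inj₂ y≡sz) _   = y≡sz

  straight₂ : ∀ {x y z} → Step x y → Step y z → x ≢ z → Apart₂ x z
  straight₂ (inj₁ refl) yz x≢z with refl ← forward refl yz x≢z  = inj₁ refl
  straight₂ (inj₂ refl) yz x≢z with refl ← backward refl yz x≢z = inj₂ refl

  straight₃ : ∀ {x y z w} → Step x y → Step y z → Step z w → x ≢ z → y ≢ w → Apart₃ x w
  straight₃ (inj₁ refl) yz zw x≢z y≢w with refl ← forward refl yz x≢z with refl ← forward refl zw y≢w = inj₁ refl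
  straight₃ (inj₂ refl) yz zw x≢z y≢w with refl ← backward refl yz x≢z with refl ← backward refl zw y≢w = inj₂ refl

  apart₂⇒¬step : (∀ x → x ≢ s x) → (∀ x → x ≢ s (s (s x))) → ∀ {x y} → Apart₂ x y → ¬ Step y x
  apart₂⇒¬step ≢s¹ ≢s³ (inj₁ refl) (inj₁ x≡s³x)  = ≢s³ _ x≡s³x
  apart₂⇒¬step ≢s¹ ≢s³ (inj₁ refl) (inj₂ s²x≡sx) = ≢s¹ _ (sym (s-injective s²x≡sx))
  apart₂⇒¬step ≢s¹ ≢s³ (inj₂ refl) (inj₁ s²y≡sy) = ≢s¹ _ (sym (s-injective s²y≡sy))
  apart₂⇒¬step ≢s¹ ≢s³ (inj₂ refl) (inj₂ y≡s³y)  = ≢s³ _ y≡s³y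

  apart₃⇒¬step : (∀ x → x ≢ s (s x)) → (∀ x → x ≢ s (s (s (s x)))) → ∀ {x y} → Apart₃ x y → ¬ Step y x
  apart₃⇒¬step ≢s² ≢s⁴ (inj₁ refl) (inj₁ x≡s⁴x)  = ≢s⁴ _ x≡s⁴x
  apart₃⇒¬step ≢s² ≢s⁴ (inj₁ refl) (inj₂ s³x≡sx) = ≢s² _ (sym (s-injective s³x≡sx))
  apart₃⇒¬step ≢s² ≢s⁴ (inj₂ refl) (inj₁ s³y≡sy) = ≢s² _ (sym (s-injective s³y≡sy))
  apart₃⇒¬step ≢s² ≢s⁴ (inj₂ refl) (inj₂ y≡s⁴y)  = ≢s⁴ _ y≡s⁴y

module Cycle (n : ℕ) (4≤n : 4 ≤ n) where
  open Walks (next {n}) next-injective public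

  distinct : ∀ {j k} → {T (j <ᵇ k)} → {T (k ≤ᵇ 4)} → ∀ z → iterate next z j ≢ iterate next z k
  distinct {j} {k} {j<k} {k≤4} z = iterate-next-≢ z (<ᵇ⇒< j k j<k) (s≤s (≤-trans (≤ᵇ⇒≤ k 4 k≤4) 4≤n))

  light : Fin (suc n) → List (Fin (suc n))
  light x = next x ∷ prev x ∷ []

  light⇒step : ∀ {x y} → y ∈ light x → Step x y
  light⇒step     (here refl)         = inj₁ refl
  light⇒step {x} (there (here refl)) = inj₂ (sym (next-prev x))

  step⇒light : ∀ {x y} → Step x y → y ∈ light x
  step⇒light         (inj₁ y≡sx) = here y≡sx
  step⇒light {y = y} (inj₂ refl) = there (here (sym (prev-next y)))

  light-sym : ∀ {x y} → y ∈ light x → x ∈ light y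
  light-sym = step⇒light ∘ Sum.swap ∘ light⇒step

  light-irrefl : ∀ x → x ∉ light x
  light-irrefl x x∈ = [ distinct {0} {1} x , distinct {0} {1} x ]′ (light⇒step x∈)

  light-unique : ∀ x → Unique (light x)
  light-unique x = ((λ e → distinct {0} {2} x (sym (trans (cong next e) (next-prev x)))) ∷ []) ∷ [] ∷ []

-- The extremal wgraphs

module MatchingInComplete {m : ℕ} (extra : Fin (double m) → List (Fin (double m)))
    (extra-sym : ∀ {x y} → y ∈ extra x → x ∈ extra y)
    (excluded-unique : ∀ x → Unique (x ∷ mate x ∷ extra x)) where

  presentation : Presentation (double m)
  presentation = record
    { light            = λ x → mate x ∷ []
    ; allowed          = λ _ _ → true
    ; excluded         = λ x → x ∷ mate x ∷ extra x
    ; light-sym        = mate-light-sym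
    ; light-irrefl     = mate-light-irrefl
    ; light-unique     = λ _ → [] ∷ []
    ; allowed-sym      = λ _ _ → refl
    ; excluded-sym     = excluded-sym
    ; excluded-unique  = excluded-unique
    ; excluded-allowed = λ _ → All.tabulate (λ _ → _)
    ; self-excluded    = λ _ _ → here refl
    ; light-excluded   = λ { (here refl) _ → there (here refl) }
    }
    where
    excluded-sym : ∀ {x y} → y ∈ x ∷ mate x ∷ extra x → x ∈ y ∷ mate y ∷ extra y
    excluded-sym     (here refl)         = here refl
    excluded-sym {x} (there (here refl)) = there (here (sym (mate-involutive x)))
    excluded-sym     (there (there y∈))  = there (there (extra-sym y∈))

  open Presentation presentation public using (wgraph)
  open Presentation presentation using (light-degree; heavy-degree)
  open Edges wgraph public using (Edge; light; heavy; triangle)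

  regular : ∀ {b e} → (∀ x → length (extra x) ≡ e) → double m ≡ b + (2 + e) → IsRegular wgraph 1 b
  regular {b} {e} extra-length N≡ = light-degree , λ x → +-cancelʳ-≡ (2 + e) (deg (H wgraph) x) b
    (trans (cong (λ l → deg (H wgraph) x + (2 + l)) (sym (extra-length x)))
           (trans (heavy-degree x) (trans count-true N≡)))

  girth≥5 : ∀ xs → IsWCycle wgraph xs → 5 ≤ weight wgraph xs
  girth≥5 = GirthCriteria.matching⇒girth≥5 wgraph
    (λ {x} {y} {z} lxy lxz → trans (mate-light {x = x} (toWitness lxy)) (sym (mate-light {x = x} (toWitness lxz))))

wgraph[1,b,5]-even : ∀ k → ExistsWGraph 1 (2 * suc k) 5 (2 * suc k + 2)
wgraph[1,b,5]-even k = subst₂ (λ b N → ExistsWGraph 1 b 5 N) (double≡2* (1 + k)) (double-suc (1 + k))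
  (wgraph , regular (λ _ → refl) (+-comm 2 (double (1 + k))) , hasGirth wgraph (0F ∷ 1F ∷ 2F ∷ []) refl girth≥5)
  where open MatchingInComplete {2 + k} (λ _ → []) (λ ()) (λ x → (≢-sym (mate-≢ x) ∷ []) ∷ [] ∷ [])

module CompleteMinusAntipodal (k : ℕ) where
  m : ℕ
  m = 3 + k

  σ : Fin (double m) → Fin (double m)
  σ = rotate m

  σ-involutive : ∀ x → σ (σ x) ≡ x
  σ-involutive x = trans (rotate-rotate m m x) (trans (cong (λ i → rotate i x) (sym (double≡+ m))) (rotate-full x))

  σ-displaced : ∀ x → Displaced m (toℕ x) (toℕ (σ x))
  σ-displaced x with rotate-cases m x (subst (m ≤_) (sym (double≡+ m)) (m≤m+n m m))
  ... | inj₁ p = inj₁ p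
  ... | inj₂ p = inj₂ (+-cancelʳ-≡ m (toℕ x) (toℕ (σ x) + m)
                   (sym (trans (+-assoc (toℕ (σ x)) m m) (trans (cong (toℕ (σ x) +_) (sym (double≡+ m))) p))))

  σ-avoids : ∀ {x y d} → Displaced d (toℕ x) (toℕ y) → d ≢ m → σ x ≢ y
  σ-avoids {x} dxy d≢m σx≡y =
    d≢m (displaced-unique dxy (subst (λ z → Displaced m (toℕ x) (toℕ z)) σx≡y (σ-displaced x)))

  σ-sym : ∀ {x y} → y ∈ σ x ∷ [] → x ∈ σ y ∷ []
  σ-sym {x} (here refl) = here (sym (σ-involutive x))

  excluded-unique : ∀ x → Unique (x ∷ mate x ∷ σ x ∷ [])
  excluded-unique x =
    (≢-sym (mate-≢ x) ∷ ≢-sym (σ-avoids {x} {x} {0} (inj₁ (sym (+-identityʳ (toℕ x)))) (λ ())) ∷ []) ∷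
    (≢-sym (σ-avoids {x} {mate x} {1} (mate-displaced x) (λ ())) ∷ []) ∷ [] ∷ []

  open MatchingInComplete {m} (λ x → σ x ∷ []) σ-sym excluded-unique public

wgraph[1,b,5]-odd : ∀ k → ExistsWGraph 1 (1 + 2 * suc k) 5 (1 + 2 * suc k + 3)
wgraph[1,b,5]-odd k = subst₂ (λ b N → ExistsWGraph 1 b 5 N) (cong suc (double≡2* (1 + k)))
  (trans (cong (4 +_) (double≡2* (1 + k))) (sym (cong suc (+-comm (2 * suc k) 3))))
  (wgraph , regular (λ _ → refl) (sym (cong suc (+-comm (double (1 + k)) 3))) ,
   (_ , triangle {x = 0F} (light _) (heavy heavy-1-2) (heavy heavy-2-0)) , girth≥5)
  where
  open CompleteMinusAntipodal k
  heavy-1-2 : T (H wgraph 1F 2F)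
  heavy-1-2 = fromWitnessFalse λ { (there (there (here 2≡σ1))) → σ-avoids {1F} {2F} (inj₁ refl) (λ ()) (sym 2≡σ1) }
  heavy-2-0 : T (H wgraph 2F 0F)
  heavy-2-0 = fromWitnessFalse λ { (there (there (here 0≡σ2))) → σ-avoids {2F} {0F} (inj₂ refl) (λ ()) (sym 0≡σ2) }

module MatchingInBipartite (m : ℕ) where

  presentation : Presentation (double m)
  presentation = record
    { light            = λ x → mate x ∷ []
    ; allowed          = λ x y → parity x xor parity y
    ; excluded         = λ x → mate x ∷ []
    ; light-sym        = mate-light-sym
    ; light-irrefl     = mate-light-irrefl
    ; light-unique     = λ _ → [] ∷ []
    ; allowed-sym      = λ x y → xor-comm (parity x) (parity y)
    ; excluded-sym     = mate-light-sym
    ; excluded-unique  = λ _ → [] ∷ []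
    ; excluded-allowed = λ x → subst (λ p → T (parity x xor p)) (sym (parity-mate x)) (opposite (parity x)) ∷ []
    ; self-excluded    = λ x t → ⊥-elim (subst T (xor-same (parity x)) t)
    ; light-excluded   = λ y∈ _ → y∈
    }
    where
    opposite : ∀ a → T (a xor not a)
    opposite true  = _
    opposite false = _

  open Presentation presentation public using (wgraph)
  open Presentation presentation using (light-degree; heavy-degree)
  open Edges wgraph

  regular : ∀ {b} → m ≡ b + 1 → IsRegular wgraph 1 b
  regular {b} m≡ = light-degree , λ x → +-cancelʳ-≡ 1 (deg (H wgraph) x) b
    (trans (heavy-degree x) (trans (count-parity m (parity x)) m≡))

  girth≥6 : ∀ xs → IsWCycle wgraph xs → 6 ≤ weight wgraph xs
  girth≥6 = GirthCriteria.bipartite-matching⇒girth≥6 wgraph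
    (λ {x} {y} {z} lxy lxz → trans (mate-light {x = x} (toWitness lxy)) (sym (mate-light {x = x} (toWitness lxz))))
    parity (λ {x} {y} → flip {x} {y})
    where
    flip : ∀ {x y} → Adj x y → parity y ≡ not (parity x)
    flip {x} {y} axy with adj⇒light⊎heavy {x} {y} axy
    ... | inj₁ lxy = trans (cong parity (mate-light {x = x} (toWitness lxy))) (parity-mate x)
    ... | inj₂ hxy = opposite (parity x) (parity y) (proj₁ (Equivalence.to (T-∧ {parity x xor parity y}) hxy))
      where
      opposite : ∀ a b → T (a xor b) → b ≡ not a
      opposite true  false _ = refl
      opposite false true  _ = refl

wgraph[1,b,6] : ∀ k → ExistsWGraph 1 (suc k) 6 (2 * suc k + 2)
wgraph[1,b,6] k = subst (ExistsWGraph 1 (suc k) 6) (double-suc (suc k))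
  (wgraph , regular (+-comm 1 (suc k)) , hasGirth wgraph (0F ∷ 1F ∷ 2F ∷ 3F ∷ []) refl girth≥6)
  where open MatchingInBipartite (2 + k)

module CycleInComplete (b : ℕ) where
  open Cycle (4 + b) (m≤m+n 4 b)

  Near : Fin (5 + b) → Fin (5 + b) → Set
  Near x y = y ≡ x ⊎ Step x y ⊎ Apart₂ x y

  ball : Fin (5 + b) → List (Fin (5 + b))
  ball x = map (iterate next (prev (prev x))) (0 ∷ 1 ∷ 2 ∷ 3 ∷ 4 ∷ [])

  centre : ∀ (x : Fin (5 + b)) → x ≡ next (next (prev (prev x)))
  centre x = sym (trans (cong next (next-prev (prev x))) (next-prev x))

  ball⇒near : ∀ {x y} → y ∈ ball x → Near x y
  ball⇒near {x} (here refl)                                 = inj₂ (inj₂ (inj₂ (centre x)))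
  ball⇒near {x} (there (here refl))                         = inj₂ (inj₁ (inj₂ (centre x)))
  ball⇒near {x} (there (there (here refl)))                 = inj₁ (sym (centre x))
  ball⇒near {x} (there (there (there (here refl))))         = inj₂ (inj₁ (inj₁ (cong next (sym (centre x)))))
  ball⇒near {x} (there (there (there (there (here refl))))) = inj₂ (inj₂ (inj₁ (cong (next ∘ next) (sym (centre x)))))

  near⇒ball : ∀ {x y} → Near x y → y ∈ ball x
  near⇒ball {x} (inj₁ refl)               = there (there (here (centre x)))
  near⇒ball {x} (inj₂ (inj₁ (inj₁ refl))) = there (there (there (here (cong next (centre x)))))
  near⇒ball {x} (inj₂ (inj₁ (inj₂ refl))) = there (here (next-injective (centre x)))
  near⇒ball {x} (inj₂ (inj₂ (inj₁ refl))) = there (there (there (there (here (cong (next ∘ next) (centre x))))))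
  near⇒ball {x} (inj₂ (inj₂ (inj₂ refl))) = here (next-injective (next-injective (centre x)))

  near-sym : ∀ {x y} → Near x y → Near y x
  near-sym = Sum.map sym (Sum.map Sum.swap Sum.swap)

  ball-unique : ∀ x → Unique (ball x)
  ball-unique x =
    (distinct {0} {1} z ∷ distinct {0} {2} z ∷ distinct {0} {3} z ∷ distinct {0} {4} z ∷ []) ∷
    (distinct {1} {2} z ∷ distinct {1} {3} z ∷ distinct {1} {4} z ∷ []) ∷
    (distinct {2} {3} z ∷ distinct {2} {4} z ∷ []) ∷ (distinct {3} {4} z ∷ []) ∷ [] ∷ []
    where z = prev (prev x)

  presentation : Presentation (5 + b)
  presentation = record
    { light            = light
    ; allowed          = λ _ _ → true
    ; excluded         = ball
    ; light-sym        = light-sym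
    ; light-irrefl     = light-irrefl
    ; light-unique     = light-unique
    ; allowed-sym      = λ _ _ → refl
    ; excluded-sym     = near⇒ball ∘ near-sym ∘ ball⇒near
    ; excluded-unique  = ball-unique
    ; excluded-allowed = λ _ → _ ∷ _ ∷ _ ∷ _ ∷ _ ∷ []
    ; self-excluded    = λ x _ → near⇒ball (inj₁ refl)
    ; light-excluded   = λ {x} y∈ _ → near⇒ball {x} (inj₂ (inj₁ (light⇒step y∈)))
    }

  open Presentation presentation public using (wgraph)
  open Presentation presentation using (light-degree; heavy-degree)
  open Edges wgraph

  regular : IsRegular wgraph 2 b
  regular = light-degree , (λ x → +-cancelʳ-≡ 5 _ b (trans (heavy-degree x) (trans count-true (+-comm 5 b))))

  girth≥5 : ∀ xs → IsWCycle wgraph xs → 5 ≤ weight wgraph xs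
  girth≥5 = GirthCriteria.girth≥5 wgraph no-light-cherry no-light-square
    where
    step : ∀ {x y} → Light x y → Step x y
    step = light⇒step ∘ toWitness
    no-light-cherry : ∀ {x y z} → Light x y → Light y z → x ≢ z → ¬ Adj z x
    no-light-cherry {x} {y} {z} lxy lyz x≢z azx
      with straight₂ (step lxy) (step lyz) x≢z | adj⇒light⊎heavy {z} {x} azx
    ... | apart | inj₁ lzx = apart₂⇒¬step (distinct {0} {1}) (distinct {0} {3}) apart (step lzx)
    ... | apart | inj₂ hzx = toWitnessFalse hzx (near⇒ball (inj₂ (inj₂ (Sum.swap apart))))
    no-light-square : ∀ {x y z w} → Light x y → Light y z → Light z w → Light w x → x ≢ z → y ≢ w → ⊥
    no-light-square lxy lyz lzw lwx x≢z y≢w =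
      apart₃⇒¬step (distinct {0} {2}) (distinct {0} {4})
                   (straight₃ (step lxy) (step lyz) (step lzw) x≢z y≢w) (step lwx)

wgraph[2,b,5] : ∀ b → ExistsWGraph 2 b 5 (b + 5)
wgraph[2,b,5] b = subst (ExistsWGraph 2 b 5) (+-comm 5 b) (on-5+b b)
  where
  on-5+b : ∀ b → ExistsWGraph 2 b 5 (5 + b)
  on-5+b zero    = wgraph , regular , hasGirth wgraph (0F ∷ 1F ∷ 2F ∷ 3F ∷ 4F ∷ []) refl girth≥5
    where open CycleInComplete 0
  on-5+b (suc b) = wgraph , regular , hasGirth wgraph (0F ∷ 1F ∷ 2F ∷ 3F ∷ []) refl girth≥5
    where open CycleInComplete (suc b)

module CycleInParityClasses (b : ℕ) where
  open Cycle (suc (double (2 + b))) (s≤s (s≤s (s≤s (s≤s z≤n))))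

  V : Set
  V = Fin (double (3 + b))

  Near : V → V → Set
  Near x y = y ≡ x ⊎ Apart₂ x y

  ball : V → List V
  ball x = map (iterate next (prev (prev x))) (0 ∷ 2 ∷ 4 ∷ [])

  centre : ∀ (x : V) → x ≡ next (next (prev (prev x)))
  centre x = sym (trans (cong next (next-prev (prev x))) (next-prev x))

  ball⇒near : ∀ {x y : V} → y ∈ ball x → Near x y
  ball⇒near {x} (here refl)                 = inj₂ (inj₂ (centre x))
  ball⇒near {x} (there (here refl))         = inj₁ (sym (centre x))
  ball⇒near {x} (there (there (here refl))) = inj₂ (inj₁ (cong (next ∘ next) (sym (centre x))))

  near⇒ball : ∀ {x y : V} → Near x y → y ∈ ball x
  near⇒ball {x} (inj₁ refl)        = there (here (centre x))
  near⇒ball {x} (inj₂ (inj₁ refl)) = there (there (here (cong (next ∘ next) (centre x))))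
  near⇒ball {x} (inj₂ (inj₂ refl)) = here (next-injective (next-injective (centre x)))

  parity-next′ : ∀ (x : V) → parity (next x) ≡ not (parity x)
  parity-next′ = parity-next refl

  parity-step : ∀ {x y : V} → Step x y → parity y ≡ not (parity x)
  parity-step {x} (inj₁ refl) = parity-next′ x
  parity-step {y = y} (inj₂ refl) = trans (sym (not-involutive (parity y))) (cong not (sym (parity-next′ y)))

  parity-next² : ∀ (x : V) → parity (next (next x)) ≡ parity x
  parity-next² x = trans (parity-next′ (next x)) (trans (cong not (parity-next′ x)) (not-involutive _))

  parity-near : ∀ {x y : V} → Near x y → parity y ≡ parity x
  parity-near         (inj₁ refl)        = refl
  parity-near {x}     (inj₂ (inj₁ refl)) = parity-next² x
  parity-near {y = y} (inj₂ (inj₂ refl)) = sym (parity-next² y)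

  same-parity : ∀ a b → T (not (a xor b)) → b ≡ a
  same-parity true  true  _ = refl
  same-parity false false _ = refl

  same-parity-refl : ∀ a → T (not (a xor a))
  same-parity-refl true  = _
  same-parity-refl false = _

  ball-allowed : ∀ x → All (λ y → T (not (parity x xor parity y))) (ball x)
  ball-allowed x = All.tabulate (λ y∈ → subst (λ p → T (not (parity x xor p)))
                                              (sym (parity-near (ball⇒near {x} y∈))) (same-parity-refl (parity x)))

  light-not-allowed : ∀ {x y} → y ∈ light x → ¬ T (not (parity x xor parity y))
  light-not-allowed {x} {y} y∈ allowed =
    not-¬ refl (trans (sym (same-parity (parity x) (parity y) allowed)) (parity-step (light⇒step {x} y∈)))

  presentation : Presentation (double (3 + b))
  presentation = record
    { light            = light
    ; allowed          = λ x y → not (parity x xor parity y)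
    ; excluded         = ball
    ; light-sym        = light-sym
    ; light-irrefl     = light-irrefl
    ; light-unique     = light-unique
    ; allowed-sym      = λ x y → cong not (xor-comm (parity x) (parity y))
    ; excluded-sym     = near⇒ball ∘ Sum.map sym Sum.swap ∘ ball⇒near
    ; excluded-unique  = λ x → let z = prev (prev x) in
                         (distinct {0} {2} z ∷ distinct {0} {4} z ∷ []) ∷ (distinct {2} {4} z ∷ []) ∷ [] ∷ []
    ; excluded-allowed = ball-allowed
    ; self-excluded    = λ x _ → near⇒ball (inj₁ refl)
    ; light-excluded   = λ {x} y∈ allowed → ⊥-elim (light-not-allowed {x} y∈ allowed)
    }

  open Presentation presentation public using (wgraph)
  open Presentation presentation using (light-degree; heavy-degree)
  open Edges wgraph

  regular : IsRegular wgraph 2 b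
  regular = light-degree , λ x → +-cancelʳ-≡ 3 (deg (H wgraph) x) b (begin
    deg (H wgraph) x + 3
      ≡⟨ heavy-degree x ⟩
    count (λ (y : V) → not (parity x xor parity y))
      ≡⟨ count-cong {double (3 + b)} (λ y → not-distribˡ-xor (parity x) (parity y)) ⟩
    count (λ (y : V) → not (parity x) xor parity y)
      ≡⟨ count-parity (3 + b) (not (parity x)) ⟩
    3 + b
      ≡⟨ +-comm 3 b ⟩
    b + 3 ∎)
    where open ≡-Reasoning

  girth≥6 : ∀ xs → IsWCycle wgraph xs → 6 ≤ weight wgraph xs
  girth≥6 = GirthCriteria.girth≥6 wgraph no-light-triangle no-light-path₃ no-light-pentagon
    where
    step : ∀ {x y : V} → Light x y → Step x y
    step {x} = light⇒step {x} ∘ toWitness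
    flip : ∀ {x y : V} → Light x y → parity y ≡ not (parity x)
    flip {x} {y} = parity-step ∘ step {x} {y}
    flip² : ∀ {x y z : V} → Light x y → Light y z → parity z ≡ parity x
    flip² {x} {y} {z} lxy lyz = trans (flip {y} {z} lyz) (trans (cong not (flip {x} {y} lxy)) (not-involutive _))
    keep : ∀ {x y : V} → Heavy x y → parity y ≡ parity x
    keep {x} {y} h = same-parity (parity x) (parity y) (proj₁ (Equivalence.to (T-∧ {not (parity x xor parity y)}) h))
    far : ∀ {x y : V} → Heavy x y → ¬ Near x y
    far {x} {y} h = toWitnessFalse (proj₂ (Equivalence.to (T-∧ {not (parity x xor parity y)}) h)) ∘ near⇒ball {x}
    odd : ∀ {x : V} → parity x ≡ not (parity x) → ⊥
    odd = not-¬ refl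

    no-light-triangle : ∀ {x y z} → Light x y → Adj y z → Adj z x → ⊥
    no-light-triangle {x} {y} {z} lxy ayz azx with adj⇒light⊎heavy {y} {z} ayz | adj⇒light⊎heavy {z} {x} azx
    ... | inj₁ lyz | inj₁ lzx = odd {x} (trans (flip {z} lzx) (cong not (flip² {x} lxy lyz)))
    ... | inj₂ hyz | inj₂ hzx = odd {x} (trans (keep {z} hzx) (trans (keep {y} hyz) (flip {x} lxy)))
    ... | inj₁ lyz | inj₂ hzx =
      far {z} hzx (inj₂ (Sum.swap (straight₂ (step {x} lxy) (step {y} lyz) (≢-sym (adj-≢ azx)))))
    ... | inj₂ hyz | inj₁ lzx =
      far {y} hyz (inj₂ (Sum.swap (straight₂ (step {z} lzx) (step {x} lxy) (≢-sym (adj-≢ ayz)))))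
    no-light-path₃ : ∀ {x y z w} → Light x y → Light y z → Light z w → Adj w x → x ≢ z → y ≢ w → ⊥
    no-light-path₃ {x} {y} {z} {w} lxy lyz lzw awx x≢z y≢w with adj⇒light⊎heavy {w} {x} awx
    ... | inj₁ lwx = apart₃⇒¬step (distinct {0} {2}) (distinct {0} {4})
                                  (straight₃ (step {x} lxy) (step {y} lyz) (step {z} lzw) x≢z y≢w) (step {w} lwx)
    ... | inj₂ hwx = odd {x} (trans (keep {w} hwx) (trans (flip {z} lzw) (cong not (flip² {x} lxy lyz))))
    no-light-pentagon : ∀ {x y z w v} → Light x y → Light y z → Light z w → Light w v → Light v x → ⊥
    no-light-pentagon {x} {y} {z} {w} {v} lxy lyz lzw lwv lvx =
      odd {x} (trans (flip {v} lvx) (cong not (trans (flip² {z} lzw lwv) (flip² {x} lxy lyz))))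

wgraph[2,b,6] : ∀ b → ExistsWGraph 2 b 6 (2 * b + 6)
wgraph[2,b,6] b = subst (ExistsWGraph 2 b 6) (trans (cong (6 +_) (double≡2* b)) (+-comm 6 (2 * b))) (on-6+2b b)
  where
  on-6+2b : ∀ b → ExistsWGraph 2 b 6 (double (3 + b))
  on-6+2b zero    = wgraph , regular , hasGirth wgraph (0F ∷ 1F ∷ 2F ∷ 3F ∷ 4F ∷ 5F ∷ []) refl girth≥6
    where open CycleInParityClasses 0
  on-6+2b (suc b) = wgraph , regular , hasGirth wgraph (1F ∷ 2F ∷ 6F ∷ 5F ∷ []) refl girth≥6
    where open CycleInParityClasses (suc b)

-- Minimum orders

LowerBound : ℕ → ℕ → ℕ → ℕ → Set
LowerBound a b g N = ∀ {M} (G : WGraph M) → IsRegular G a b → HasGirth G g → N ≤ M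

minOrder : ∀ {a b g N} → ExistsWGraph a b g N → LowerBound a b g N → MinOrder a b g N
minOrder exists bound = exists , λ { M M<N (G , regular , girth) → <⇒≱ M<N (bound G regular girth) }

n[1,b,5]-even : ∀ b → (∃ λ k → b ≡ 2 * k) → 2 ≤ b → MinOrder 1 b 5 (b + 2)
n[1,b,5]-even .(2 * suc k) (suc k , refl) _ = minOrder (wgraph[1,b,5]-even k) (λ G → LowerBounds.order≥b+2 G)

n[1,b,5]-odd : ∀ b → (∃ λ k → b ≡ 1 + 2 * k) → 3 ≤ b → MinOrder 1 b 5 (b + 3)
n[1,b,5]-odd .1               (zero  , refl) (s≤s ())
n[1,b,5]-odd .(1 + 2 * suc k) (suc k , refl) _ =
  minOrder (wgraph[1,b,5]-odd k) (λ G → LowerBounds.order≥b+3 G {k = suc k} refl)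

n[2,b,5] : ∀ b → MinOrder 2 b 5 (b + 5)
n[2,b,5] b = minOrder (wgraph[2,b,5] b) (λ G → LowerBounds.order≥b+5 G)

n[1,b,6] : ∀ b → 1 ≤ b → MinOrder 1 b 6 (2 * b + 2)
n[1,b,6] (suc k) _ = minOrder (wgraph[1,b,6] k) (λ G → LowerBounds.order≥2b+2 G)

n[2,b,6] : ∀ b → MinOrder 2 b 6 (2 * b + 6)
n[2,b,6] b = minOrder (wgraph[2,b,6] b) (λ G → LowerBounds.order≥2b+6 G)

theorem18 : ∀ (b : ℕ) →
    ((∃ λ k → b ≡ 2 * k) → 2 ≤ b → MinOrder 1 b 5 (b + 2)) ×
    ((∃ λ k → b ≡ 1 + 2 * k) → 3 ≤ b → MinOrder 1 b 5 (b + 3)) ×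
    MinOrder 2 b 5 (b + 5) ×
    (1 ≤ b → MinOrder 1 b 6 (2 * b + 2)) ×
    MinOrder 2 b 6 (2 * b + 6)
theorem18 b = n[1,b,5]-even b , n[1,b,5]-odd b , n[2,b,5] b , n[1,b,6] b , n[2,b,6] b
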